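{- Let $k \ge 3$ be an integer and let $\mathbb{T} = \{ T_n = \tfrac{n(n+1)}{2} : n \ge 1\} = \{1,3,6,10,15,\dots\}$ be the set of positive triangular numbers. If $f$ is a multiplicative function such that \[ f(x_1+x_2+\dots+x_k) = f(x_1)+f(x_2)+\dots+f(x_k) \] for all $x_1,\dots,x_k \in \mathbb{T}$, then $f(n)=n$ for every positive integer $n$.
   Context: A multiplicative function is a complex-valued function $f$ on the positive integers, not identically zero, with $f(mn)=f(m)f(n)$ whenever $\gcd(m,n)=1$. -}

module Defs where

open import Level using (Level)
open import Data.Nat using (ℕ; zero; suc; _*_; _≤_)
open import Data.Nat.DivMod using (_/_)
open import Data.Nat.Coprimality using (Coprime)
open import Data.Fin using (Fin; zero; suc)
open import Data.Product using (Σ; _×_; ∃-syntax)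
open import Relation.Nullary using (¬_)
open import Relation.Binary.PropositionalEquality using (_≡_)
open import Algebra.Bundles using (CommutativeRing)

tri : ℕ → ℕ
tri m = (m * suc m) / 2

IsPosTriangular : ℕ → Set
IsPosTriangular x = ∃[ m ] (1 ≤ m × x ≡ tri m)

sumℕ : ∀ {k} → (Fin k → ℕ) → ℕ
sumℕ {zero}  x = 0
sumℕ {suc k} x = x zero Data.Nat.+ sumℕ (λ i → x (suc i))

module _ {c ℓ : Level} (R : CommutativeRing c ℓ) where
  open CommutativeRing R using (Carrier; _≈_; _+_; 0#; 1#) renaming (_*_ to _*ᴿ_)

  sumR : ∀ {k} → (Fin k → Carrier) → Carrier
  sumR {zero}  y = 0#
  sumR {suc k} y = y zero + sumR (λ i → y (suc i))

  ι : ℕ → Carrier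
  ι zero    = 0#
  ι (suc n) = 1# + ι n

  -- R is a field of characteristic zero (stand-in for ℂ).
  record IsChar0Field : Set (c Level.⊔ ℓ) where
    field
      inverse  : ∀ x → ¬ (x ≈ 0#) → Σ Carrier (λ y → x *ᴿ y ≈ 1#)
      char0    : ∀ n → ¬ (ι (suc n) ≈ 0#)

  -- f : ℤ⁺ → R (values at 0 are irrelevant) is multiplicative:
  -- not identically zero on positive integers, and f(mn) = f(m) f(n) for coprime m, n ≥ 1.
  IsMultiplicative : (ℕ → Carrier) → Set ℓ
  IsMultiplicative f =
    (Σ ℕ λ n → 1 ≤ n × ¬ (f n ≈ 0#)) ×
    (∀ m n → 1 ≤ m → 1 ≤ n → Coprime m n → f (m * n) ≈ f m *ᴿ f n)

module Submission where

-- Write T_c for the c-th triangular number and F(c) = f(T_c).  Padding with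
-- k - 3 copies of T_1 = 1 shows that F is "triangularly additive": for
-- positive indices, T_a + T_b + T_c = T_d + T_e + T_g implies
-- F(a) + F(b) + F(c) = F(d) + F(e) + F(g).  Such functions form a module
-- containing the constants and c ↦ T_c, and, when there is no 2-torsion, a
-- triangularly additive function is determined by its values at 1 and 2:
-- the identity T_{n+3} + T_1 + T_n = T_{n+2} + T_2 + T_{n+1} gives a
-- recurrence, and T_3 + T_3 + T_5 = T_2 + T_2 + T_6 fixes the remaining
-- freedom.  Comparing values at 1 and 2 yields 2F(c) + f(3) + T_c =
-- f(3) T_c + 3; one more padding identity forces f(3) = 3, hence F(c) = T_c.
-- Finally T_{2a} = a(2a+1) and T_{2a+1} = (2a+1)(a+1) are products of coprime
-- factors, so multiplicativity propagates f(a) = a to f(a+1).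

open import Defs
open import Level using (Level; _⊔_)
open import Data.Nat as Nat using (ℕ; zero; suc; _≤_; s≤s; z≤n; NonZero; >-nonZero⁻¹)
import Data.Nat.Properties as ℕₚ
open import Data.Nat.DivMod using (_/_; m*n/n≡m; +-distrib-/-∣ʳ)
open import Data.Nat.Divisibility using (divides)
open import Data.Nat.Coprimality using (Coprime; coprime-+; 1-coprimeTo)
import Data.Nat.Coprimality as Coprime
open import Data.Nat.Tactic.RingSolver using (solve-∀)
open import Data.Fin using (Fin; zero; suc)
open import Data.Vec.Functional using (_∷_)
open import Data.Product using (_×_; _,_; proj₁; proj₂)
open import Relation.Nullary using (¬_)
open import Relation.Binary.PropositionalEquality as ≡ using (_≡_)
open import Algebra.Bundles using (CommutativeRing)

module _ where
  open Nat using (_+_; _*_)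
  open ≡ using (refl; cong; subst)
  open ≡.≡-Reasoning

  tri-suc : ∀ m → tri (suc m) ≡ tri m + suc m
  tri-suc m = begin
    (suc m * suc (suc m)) / 2        ≡⟨ cong (_/ 2) (expand m) ⟩
    (m * suc m + suc m * 2) / 2      ≡⟨ +-distrib-/-∣ʳ (m * suc m) (divides (suc m) refl) ⟩
    tri m + (suc m * 2) / 2          ≡⟨ cong (tri m +_) (m*n/n≡m (suc m) 2) ⟩
    tri m + suc m                    ∎
    where
    expand : ∀ m → suc m * suc (suc m) ≡ m * suc m + suc m * 2
    expand = solve-∀

  tri-double : ∀ m → 2 * tri m ≡ m * suc m
  tri-double zero    = refl
  tri-double (suc m) = begin
    2 * tri (suc m)           ≡⟨ cong (2 *_) (tri-suc m) ⟩
    2 * (tri m + suc m)       ≡⟨ ℕₚ.*-distribˡ-+ 2 (tri m) (suc m) ⟩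
    2 * tri m + 2 * suc m     ≡⟨ cong (_+ 2 * suc m) (tri-double m) ⟩
    m * suc m + 2 * suc m     ≡⟨ collect m ⟩
    suc m * suc (suc m)       ∎
    where
    collect : ∀ m → m * suc m + 2 * suc m ≡ suc m * suc (suc m)
    collect = solve-∀

  tri-even : ∀ a → tri (a + a) ≡ a * suc (a + a)
  tri-even a = ℕₚ.*-cancelˡ-≡ _ _ 2 (≡.trans (tri-double (a + a)) (regroup a))
    where
    regroup : ∀ a → (a + a) * suc (a + a) ≡ 2 * (a * suc (a + a))
    regroup = solve-∀

  tri-odd : ∀ a → tri (suc (a + a)) ≡ suc (a + a) * suc a
  tri-odd a = ℕₚ.*-cancelˡ-≡ _ _ 2 (≡.trans (tri-double (suc (a + a))) (regroup a))
    where
    regroup : ∀ a → suc (a + a) * suc (suc (a + a)) ≡ 2 * (suc (a + a) * suc a)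
    regroup = solve-∀

  -- T_{n+3} + T_1 + T_n = T_{n+2} + T_2 + T_{n+1}, because
  -- T_{n+3} - T_{n+2} = n + 3 = (T_2 - T_1) + (T_{n+1} - T_n).
  -- This identity drives the recurrence for triangularly additive functions.
  tri-exchange : ∀ n → tri (3 + n) + (tri 1 + tri n) ≡ tri (2 + n) + (tri 2 + tri (1 + n))
  tri-exchange n = begin
    tri (3 + n) + (1 + tri n)             ≡⟨ cong (_+ (1 + tri n)) (tri-suc (2 + n)) ⟩
    tri (2 + n) + (3 + n) + (1 + tri n)   ≡⟨ rearrange (tri (2 + n)) (tri n) n ⟩
    tri (2 + n) + (3 + (tri n + suc n))   ≡⟨ cong (λ t → tri (2 + n) + (3 + t)) (≡.sym (tri-suc n)) ⟩
    tri (2 + n) + (3 + tri (1 + n))       ∎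
    where
    rearrange : ∀ x y n → x + (3 + n) + (1 + y) ≡ x + (3 + (y + suc n))
    rearrange = solve-∀

  coprime-even-factors : ∀ a → Coprime a (suc (a + a))
  coprime-even-factors a =
    Coprime.sym (subst (λ n → Coprime n a) (sum≡ a) (coprime-+ (coprime-+ (1-coprimeTo a))))
    where
    sum≡ : ∀ a → a + (a + 1) ≡ suc (a + a)
    sum≡ = solve-∀

  coprime-odd-factors : ∀ a → Coprime (suc (a + a)) (suc a)
  coprime-odd-factors a =
    ≡.subst₂ Coprime (sum≡ a) (ℕₚ.+-comm a 1) (coprime-+ (Coprime.sym (coprime-+ (1-coprimeTo a))))
    where
    sum≡ : ∀ a → (a + 1) + a ≡ suc (a + a)
    sum≡ = solve-∀

  tri-pos : ∀ a → .{{NonZero a}} → IsPosTriangular (tri a)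
  tri-pos a = a , >-nonZero⁻¹ a , refl

  sumℕ-ones : ∀ n → sumℕ {n} (λ _ → 1) ≡ n
  sumℕ-ones zero    = refl
  sumℕ-ones (suc n) = cong suc (sumℕ-ones n)

  +-regroup : ∀ x y z w → x + (y + (z + w)) ≡ (x + (y + z)) + w
  +-regroup = solve-∀

module RingTheory {c ℓ : Level} (R : CommutativeRing c ℓ) where
  open CommutativeRing R
  open import Relation.Binary.Reasoning.Setoid setoid
  open import Algebra.Solver.Ring.NaturalCoefficients.Default commutativeSemiring
    using (solve; _:+_; _:*_; _:=_; con; Polynomial)
  open import Algebra.Properties.Semiring.Mult semiring
    using (×-homo-+; ×1-homo-*) renaming (_×_ to _·_)
  open import Algebra.Properties.Ring ring using (-1*x≈-x)
  open import Algebra.Properties.Group +-group using (∙-cancelʳ; x∙y⁻¹≈ε⇒x≈y; x≈y⇒x∙y⁻¹≈ε)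

  ι≡·1 : ∀ n → ι R n ≡ n · 1#
  ι≡·1 zero    = ≡.refl
  ι≡·1 (suc n) = ≡.cong (1# +_) (ι≡·1 n)

  ι-+ : ∀ m n → ι R (m Nat.+ n) ≈ ι R m + ι R n
  ι-+ m n rewrite ι≡·1 (m Nat.+ n) | ι≡·1 m | ι≡·1 n = ×-homo-+ 1# m n

  ι-* : ∀ m n → ι R (m Nat.* n) ≈ ι R m * ι R n
  ι-* m n rewrite ι≡·1 (m Nat.* n) | ι≡·1 m | ι≡·1 n = ×1-homo-* m n

  -- ι n as a solver expression; its meaning is ι R n by computation.
  :ι : ∀ {m} → ℕ → Polynomial m
  :ι zero    = con 0
  :ι (suc n) = con 1 :+ :ι n

  sumR-ones : ∀ {x} → x ≈ 1# → ∀ n → sumR R {n} (λ _ → x) ≈ ι R n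
  sumR-ones x≈1 zero    = refl
  sumR-ones x≈1 (suc n) = +-cong x≈1 (sumR-ones x≈1 n)

  TriangularlyAdditive : (ℕ → Carrier) → Set ℓ
  TriangularlyAdditive h = ∀ a b c d e g →
    .{{NonZero a}} → .{{NonZero b}} → .{{NonZero c}} →
    .{{NonZero d}} → .{{NonZero e}} → .{{NonZero g}} →
    tri a Nat.+ (tri b Nat.+ tri c) ≡ tri d Nat.+ (tri e Nat.+ tri g) →
    h a + (h b + h c) ≈ h d + (h e + h g)

  TA-cong : ∀ {u v} → (∀ n → u n ≈ v n) → TriangularlyAdditive u → TriangularlyAdditive v
  TA-cong {u} {v} u≈v tu a b c d e g eq = begin
    v a + (v b + v c)  ≈⟨ sym (+-cong (u≈v a) (+-cong (u≈v b) (u≈v c))) ⟩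
    u a + (u b + u c)  ≈⟨ tu a b c d e g eq ⟩
    u d + (u e + u g)  ≈⟨ +-cong (u≈v d) (+-cong (u≈v e) (u≈v g)) ⟩
    v d + (v e + v g)  ∎

  TA-+ : ∀ {u v} → TriangularlyAdditive u → TriangularlyAdditive v →
         TriangularlyAdditive (λ n → u n + v n)
  TA-+ {u} {v} tu tv a b c d e g eq = begin
    (u a + v a) + ((u b + v b) + (u c + v c))  ≈⟨ interchange _ _ _ _ _ _ ⟩
    (u a + (u b + u c)) + (v a + (v b + v c))  ≈⟨ +-cong (tu a b c d e g eq) (tv a b c d e g eq) ⟩
    (u d + (u e + u g)) + (v d + (v e + v g))  ≈⟨ sym (interchange _ _ _ _ _ _) ⟩
    (u d + v d) + ((u e + v e) + (u g + v g))  ∎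
    where
    interchange : ∀ x y z x′ y′ z′ →
      (x + x′) + ((y + y′) + (z + z′)) ≈ (x + (y + z)) + (x′ + (y′ + z′))
    interchange = solve 6 (λ x y z x′ y′ z′ →
      (x :+ x′) :+ ((y :+ y′) :+ (z :+ z′)) := (x :+ (y :+ z)) :+ (x′ :+ (y′ :+ z′))) refl

  TA-* : ∀ {u} x → TriangularlyAdditive u → TriangularlyAdditive (λ n → x * u n)
  TA-* {u} x tu a b c d e g eq = begin
    x * u a + (x * u b + x * u c)  ≈⟨ factor _ _ _ _ ⟩
    x * (u a + (u b + u c))        ≈⟨ *-congˡ (tu a b c d e g eq) ⟩
    x * (u d + (u e + u g))        ≈⟨ sym (factor _ _ _ _) ⟩
    x * u d + (x * u e + x * u g)  ∎
    where
    factor : ∀ x y z w → x * y + (x * z + x * w) ≈ x * (y + (z + w))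
    factor = solve 4 (λ x y z w → x :* y :+ (x :* z :+ x :* w) := x :* (y :+ (z :+ w))) refl

  TA-const : ∀ x → TriangularlyAdditive (λ _ → x)
  TA-const x a b c d e g eq = refl

  TA-tri : TriangularlyAdditive (λ n → ι R (tri n))
  TA-tri a b c d e g eq = begin
    ι R (tri a) + (ι R (tri b) + ι R (tri c))  ≈⟨ sym (ι-+₃ (tri a) (tri b) (tri c)) ⟩
    ι R (tri a Nat.+ (tri b Nat.+ tri c))      ≡⟨ ≡.cong (ι R) eq ⟩
    ι R (tri d Nat.+ (tri e Nat.+ tri g))      ≈⟨ ι-+₃ (tri d) (tri e) (tri g) ⟩
    ι R (tri d) + (ι R (tri e) + ι R (tri g))  ∎
    where
    ι-+₃ : ∀ x y z → ι R (x Nat.+ (y Nat.+ z)) ≈ ι R x + (ι R y + ι R z)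
    ι-+₃ x y z = trans (ι-+ x _) (+-congˡ (ι-+ y z))

  TA-- : ∀ {u v} → TriangularlyAdditive u → TriangularlyAdditive v →
         TriangularlyAdditive (λ n → u n - v n)
  TA-- {v = v} tu tv =
    TA-cong (λ n → +-congˡ (-1*x≈-x (v n))) (TA-+ tu (TA-* (- 1#) tv))

  NoTwoTorsion : Set (c ⊔ ℓ)
  NoTwoTorsion = ∀ x → x + x ≈ 0# → x ≈ 0#

  private
    zero-summandˡ : ∀ {a x} → a ≈ 0# → a + x ≈ x
    zero-summandˡ a≈0 = trans (+-congʳ a≈0) (+-identityˡ _)

    zero-summandʳ : ∀ {a x} → a ≈ 0# → x + a ≈ x
    zero-summandʳ a≈0 = trans (+-congˡ a≈0) (+-identityʳ _)

  TA-vanish : NoTwoTorsion → ∀ {h} → TriangularlyAdditive h →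
    h 1 ≈ 0# → h 2 ≈ 0# → ∀ n → h (suc n) ≈ 0#
  TA-vanish no-torsion {h} th h1≈0 h2≈0 n = proj₁ (window n)
    where
    recurrence : ∀ q → h (4 Nat.+ q) + h (1 Nat.+ q) ≈ h (3 Nat.+ q) + h (2 Nat.+ q)
    recurrence q = begin
      h (4 Nat.+ q) + h (1 Nat.+ q)           ≈⟨ +-congˡ (sym (zero-summandˡ h1≈0)) ⟩
      h (4 Nat.+ q) + (h 1 + h (1 Nat.+ q))   ≈⟨ th (4 Nat.+ q) 1 (1 Nat.+ q) (3 Nat.+ q) 2 (2 Nat.+ q)
                                                    (tri-exchange (1 Nat.+ q)) ⟩
      h (3 Nat.+ q) + (h 2 + h (2 Nat.+ q))   ≈⟨ +-congˡ (zero-summandˡ h2≈0) ⟩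
      h (3 Nat.+ q) + h (2 Nat.+ q)           ∎

    -- The recurrence leaves x = h 3 free: h 4 = x, h 5 = h 6 = 2x, and then
    -- T_3 + T_3 + T_5 = T_2 + T_2 + T_6 says 4x = 2x.
    h3≈0 : h 3 ≈ 0#
    h3≈0 = no-torsion x (∙-cancelʳ (x + x) (x + x) 0# (begin
      (x + x) + (x + x)        ≈⟨ +-assoc x x (x + x) ⟩
      x + (x + (x + x))        ≈⟨ +-congˡ (+-congˡ (sym h5)) ⟩
      x + (x + h 5)            ≈⟨ th 3 3 5 2 2 6 ≡.refl ⟩
      h 2 + (h 2 + h 6)        ≈⟨ trans (zero-summandˡ h2≈0) (zero-summandˡ h2≈0) ⟩
      h 6                      ≈⟨ h6 ⟩
      x + x                    ≈⟨ sym (+-identityˡ _) ⟩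
      0# + (x + x)             ∎))
      where
      x : Carrier
      x = h 3
      h4 : h 4 ≈ x
      h4 = trans (sym (zero-summandʳ h1≈0)) (trans (recurrence 0) (zero-summandʳ h2≈0))
      h5 : h 5 ≈ x + x
      h5 = trans (sym (zero-summandʳ h2≈0)) (trans (recurrence 1) (+-congʳ h4))
      h6 : h 6 ≈ x + x
      h6 = ∙-cancelʳ x (h 6) (x + x) (trans (recurrence 2) (+-cong h5 h4))

    window : ∀ q → h (1 Nat.+ q) ≈ 0# × h (2 Nat.+ q) ≈ 0# × h (3 Nat.+ q) ≈ 0#
    window zero    = h1≈0 , h2≈0 , h3≈0
    window (suc q) =
      let (z₁ , z₂ , z₃) = window q in
      z₂ , z₃ , (begin
        h (4 Nat.+ q)                  ≈⟨ sym (zero-summandʳ z₁) ⟩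
        h (4 Nat.+ q) + h (1 Nat.+ q)  ≈⟨ recurrence q ⟩
        h (3 Nat.+ q) + h (2 Nat.+ q)  ≈⟨ zero-summandʳ z₂ ⟩
        h (3 Nat.+ q)                  ≈⟨ z₃ ⟩
        0#                             ∎)

  TA-unique : NoTwoTorsion → ∀ {u v} → TriangularlyAdditive u → TriangularlyAdditive v →
    u 1 ≈ v 1 → u 2 ≈ v 2 → ∀ n → u (suc n) ≈ v (suc n)
  TA-unique no-torsion {u} {v} tu tv u1≈v1 u2≈v2 n =
    x∙y⁻¹≈ε⇒x≈y (u (suc n)) (v (suc n))
      (TA-vanish no-torsion (TA-- tu tv) (x≈y⇒x∙y⁻¹≈ε u1≈v1) (x≈y⇒x∙y⁻¹≈ε u2≈v2) n)

  module Char0Field (char0-field : IsChar0Field R) where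
    open IsChar0Field char0-field

    *-cancelˡ-nonzero : ∀ {x y z} → ¬ (x ≈ 0#) → x * y ≈ x * z → y ≈ z
    *-cancelˡ-nonzero {x} {y} {z} x≉0 xy≈xz = begin
      y                ≈⟨ sym (*-identityˡ y) ⟩
      1# * y           ≈⟨ *-congʳ (sym x⁻¹x≈1) ⟩
      (x⁻¹ * x) * y    ≈⟨ *-assoc x⁻¹ x y ⟩
      x⁻¹ * (x * y)    ≈⟨ *-congˡ xy≈xz ⟩
      x⁻¹ * (x * z)    ≈⟨ sym (*-assoc x⁻¹ x z) ⟩
      (x⁻¹ * x) * z    ≈⟨ *-congʳ x⁻¹x≈1 ⟩
      1# * z           ≈⟨ *-identityˡ z ⟩
      z                ∎
      where
      x⁻¹ : Carrier
      x⁻¹ = proj₁ (inverse x x≉0)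
      x⁻¹x≈1 : x⁻¹ * x ≈ 1#
      x⁻¹x≈1 = trans (*-comm x⁻¹ x) (proj₂ (inverse x x≉0))

    ι-cancelˡ : ∀ n {y z} → ι R (suc n) * y ≈ ι R (suc n) * z → y ≈ z
    ι-cancelˡ n = *-cancelˡ-nonzero (char0 n)

    no-two-torsion : NoTwoTorsion
    no-two-torsion x x+x≈0 = ι-cancelˡ 1 (begin
      ι R 2 * x   ≈⟨ double x ⟩
      x + x       ≈⟨ x+x≈0 ⟩
      0#          ≈⟨ sym (zeroʳ (ι R 2)) ⟩
      ι R 2 * 0#  ∎)
      where
      double : ∀ x → ι R 2 * x ≈ x + x
      double = solve 1 (λ x → :ι 2 :* x := x :+ x) refl

    module Multiplicative (f : ℕ → Carrier) (mul : IsMultiplicative R f) where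

      -- f 1 = 1, since f n = f (n · 1) = f n · f 1 for some n with f n ≠ 0.
      f-one : f 1 ≈ 1#
      f-one = let (n , 1≤n , fn≉0) = proj₁ mul in
        sym (*-cancelˡ-nonzero fn≉0 (begin
          f n * 1#       ≈⟨ *-identityʳ (f n) ⟩
          f n            ≡⟨ ≡.cong f (≡.sym (ℕₚ.*-identityʳ n)) ⟩
          f (n Nat.* 1)  ≈⟨ proj₂ mul n 1 1≤n (s≤s z≤n) (Coprime.sym (1-coprimeTo n)) ⟩
          f n * f 1      ∎))

      transfer : ∀ m n → Coprime (suc m) (suc n) →
        f (suc m) ≈ ι R (suc m) → f (suc m Nat.* suc n) ≈ ι R (suc m Nat.* suc n) →
        f (suc n) ≈ ι R (suc n)
      transfer m n coprime fm fmn = ι-cancelˡ m (begin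
        ι R (suc m) * f (suc n)        ≈⟨ *-congʳ (sym fm) ⟩
        f (suc m) * f (suc n)          ≈⟨ sym (proj₂ mul (suc m) (suc n) (s≤s z≤n) (s≤s z≤n) coprime) ⟩
        f (suc m Nat.* suc n)          ≈⟨ fmn ⟩
        ι R (suc m Nat.* suc n)        ≈⟨ ι-* (suc m) (suc n) ⟩
        ι R (suc m) * ι R (suc n)      ∎)

      -- If f(T_c) = T_c for all c ≥ 1, then f(n) = n for all n ≥ 1: from
      -- f(a) = a, T_{2a} = a(2a+1) gives f(2a+1) = 2a+1, and then
      -- T_{2a+1} = (2a+1)(a+1) gives f(a+1) = a+1.
      identity-from-triangular : (∀ c → f (tri (suc c)) ≈ ι R (tri (suc c))) →
        ∀ n → f (suc n) ≈ ι R (suc n)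
      identity-from-triangular f-tri zero    = trans f-one (sym (+-identityʳ 1#))
      identity-from-triangular f-tri (suc m) =
        transfer (a Nat.+ a) a (coprime-odd-factors a) f-odd (at-product (a Nat.+ a) (tri-odd a))
        where
        a : ℕ
        a = suc m
        at-product : ∀ c {x} → tri (suc c) ≡ x → f x ≈ ι R x
        at-product c eq = ≡.subst (λ x → f x ≈ ι R x) eq (f-tri c)
        f-odd : f (suc (a Nat.+ a)) ≈ ι R (suc (a Nat.+ a))
        f-odd = transfer m (a Nat.+ a) (coprime-even-factors a)
          (identity-from-triangular f-tri m) (at-product (m Nat.+ a) (tri-even a))

module Characterisation {c ℓ : Level} (R : CommutativeRing c ℓ) (char0-field : IsChar0Field R)
  (j : ℕ) (f : ℕ → CommutativeRing.Carrier R) (mul : IsMultiplicative R f)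
  (additive : (x : Fin (3 Nat.+ j) → ℕ) → (∀ i → IsPosTriangular (x i)) →
     CommutativeRing._≈_ R (f (sumℕ x)) (sumR R (λ i → f (x i)))) where
  open CommutativeRing R
  open RingTheory R
  open Char0Field char0-field
  open Multiplicative f mul
  open import Relation.Binary.Reasoning.Setoid setoid
  open import Algebra.Solver.Ring.NaturalCoefficients.Default commutativeSemiring
    using (solve; _:+_; _:*_; _:=_; con)
  open import Algebra.Properties.Group +-group using (∙-cancelˡ; ∙-cancelʳ)

  F t : ℕ → Carrier
  F n = f (tri n)
  t n = ι R (tri n)

  padded-triple : ∀ a b c → .{{NonZero a}} → .{{NonZero b}} → .{{NonZero c}} →
    f (tri a Nat.+ (tri b Nat.+ (tri c Nat.+ j))) ≈ (F a + (F b + F c)) + ι R j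
  padded-triple a b c = begin
    f (tri a Nat.+ (tri b Nat.+ (tri c Nat.+ j)))  ≡⟨ ≡.cong (λ s → f (tri a Nat.+ (tri b Nat.+ (tri c Nat.+ s))))
                                                         (≡.sym (sumℕ-ones j)) ⟩
    f (sumℕ x)                                     ≈⟨ additive x x-pos ⟩
    F a + (F b + (F c + sumR R {j} (λ _ → f 1)))   ≈⟨ +-congˡ (+-congˡ (+-congˡ (sumR-ones f-one j))) ⟩
    F a + (F b + (F c + ι R j))                    ≈⟨ regroup (F a) (F b) (F c) (ι R j) ⟩
    (F a + (F b + F c)) + ι R j                    ∎
    where
    x : Fin (3 Nat.+ j) → ℕ
    x = tri a ∷ tri b ∷ tri c ∷ (λ _ → 1)
    x-pos : ∀ i → IsPosTriangular (x i)
    x-pos zero                = tri-pos a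
    x-pos (suc zero)          = tri-pos b
    x-pos (suc (suc zero))    = tri-pos c
    x-pos (suc (suc (suc _))) = tri-pos 1
    regroup : ∀ x y z w → x + (y + (z + w)) ≈ (x + (y + z)) + w
    regroup = solve 4 (λ x y z w → x :+ (y :+ (z :+ w)) := (x :+ (y :+ z)) :+ w) refl

  -- F is triangularly additive: equal padded sums, minus the common padding.
  F-additive : TriangularlyAdditive F
  F-additive a b c d e g eq = ∙-cancelʳ (ι R j) _ _ (begin
    (F a + (F b + F c)) + ι R j                    ≈⟨ sym (padded-triple a b c) ⟩
    f (tri a Nat.+ (tri b Nat.+ (tri c Nat.+ j)))  ≡⟨ ≡.cong f padded-eq ⟩
    f (tri d Nat.+ (tri e Nat.+ (tri g Nat.+ j)))  ≈⟨ padded-triple d e g ⟩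
    (F d + (F e + F g)) + ι R j                    ∎)
    where
    padded-eq : tri a Nat.+ (tri b Nat.+ (tri c Nat.+ j)) ≡ tri d Nat.+ (tri e Nat.+ (tri g Nat.+ j))
    padded-eq = ≡.trans (+-regroup (tri a) (tri b) (tri c) j)
      (≡.trans (≡.cong (Nat._+ j) eq) (≡.sym (+-regroup (tri d) (tri e) (tri g) j)))

  -- T_{j+2} = T_{j+1} + (j + 2) · T_1, so F increases by j + 2 there.
  F-step : F (2 Nat.+ j) ≈ F (1 Nat.+ j) + ι R (2 Nat.+ j)
  F-step = begin
    f (tri (2 Nat.+ j))                       ≡⟨ ≡.cong f (≡.trans (tri-suc (1 Nat.+ j))
                                                   (≡.cong (tri (1 Nat.+ j) Nat.+_) (≡.sym (sumℕ-ones (2 Nat.+ j))))) ⟩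
    f (sumℕ x)                                ≈⟨ additive x x-pos ⟩
    F (1 Nat.+ j) + sumR R {2 Nat.+ j} (λ _ → f 1)  ≈⟨ +-congˡ (sumR-ones f-one (2 Nat.+ j)) ⟩
    F (1 Nat.+ j) + ι R (2 Nat.+ j)           ∎
    where
    x : Fin (3 Nat.+ j) → ℕ
    x = tri (1 Nat.+ j) ∷ (λ _ → 1)
    x-pos : ∀ i → IsPosTriangular (x i)
    x-pos zero    = tri-pos (1 Nat.+ j)
    x-pos (suc _) = tri-pos 1

  -- 2F(n) + f(3) + T_n and f(3) T_n + 3 are triangularly additive and agree
  -- at n = 1 and n = 2, hence everywhere.
  affine-relation : ∀ n → ι R 2 * F (suc n) + (f 3 + t (suc n)) ≈ f 3 * t (suc n) + ι R 3
  affine-relation = TA-unique no-two-torsion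
    (TA-+ (TA-* (ι R 2) F-additive) (TA-+ (TA-const (f 3)) TA-tri))
    (TA-+ (TA-* (f 3) TA-tri) (TA-const (ι R 3)))
    (trans (+-congʳ (*-congˡ f-one)) (at-1 (f 3)))
    (at-2 (f 3))
    where
    at-1 : ∀ y → ι R 2 * 1# + (y + ι R 1) ≈ y * ι R 1 + ι R 3
    at-1 = solve 1 (λ y → :ι 2 :* con 1 :+ (y :+ :ι 1) := y :* :ι 1 :+ :ι 3) refl
    at-2 : ∀ y → ι R 2 * y + (y + ι R 3) ≈ y * ι R 3 + ι R 3
    at-2 = solve 1 (λ y → :ι 2 :* y :+ (y :+ :ι 3) := y :* :ι 3 :+ :ι 3) refl

  -- Comparing the affine relation at j + 1 and j + 2 via F-step gives
  -- 3(j + 2) = f(3)(j + 2).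
  f3≈3 : f 3 ≈ ι R 3
  f3≈3 = sym (ι-cancelˡ (1 Nat.+ j) (trans (*-comm N (ι R 3)) (trans 3N≈f3N (*-comm (f 3) N))))
    where
    N : Carrier
    N = ι R (2 Nat.+ j)
    t-step : t (2 Nat.+ j) ≈ t (1 Nat.+ j) + N
    t-step = trans (reflexive (≡.cong (ι R) (tri-suc (1 Nat.+ j)))) (ι-+ (tri (1 Nat.+ j)) (2 Nat.+ j))
    spread-u : ∀ a n y b → ι R 2 * (a + n) + (y + (b + n)) ≈ (ι R 2 * a + (y + b)) + ι R 3 * n
    spread-u = solve 4 (λ a n y b →
      :ι 2 :* (a :+ n) :+ (y :+ (b :+ n)) := (:ι 2 :* a :+ (y :+ b)) :+ :ι 3 :* n) refl
    spread-v : ∀ y b n → y * (b + n) + ι R 3 ≈ (y * b + ι R 3) + y * n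
    spread-v = solve 3 (λ y b n → y :* (b :+ n) :+ :ι 3 := (y :* b :+ :ι 3) :+ y :* n) refl
    3N≈f3N : ι R 3 * N ≈ f 3 * N
    3N≈f3N = ∙-cancelˡ (f 3 * t (1 Nat.+ j) + ι R 3) _ _ (begin
      (f 3 * t (1 Nat.+ j) + ι R 3) + ι R 3 * N             ≈⟨ +-congʳ (sym (affine-relation j)) ⟩
      (ι R 2 * F (1 Nat.+ j) + (f 3 + t (1 Nat.+ j))) + ι R 3 * N
                                                            ≈⟨ sym (spread-u _ _ _ _) ⟩
      ι R 2 * (F (1 Nat.+ j) + N) + (f 3 + (t (1 Nat.+ j) + N))
                                                            ≈⟨ sym (+-cong (*-congˡ F-step) (+-congˡ t-step)) ⟩
      ι R 2 * F (2 Nat.+ j) + (f 3 + t (2 Nat.+ j))         ≈⟨ affine-relation (1 Nat.+ j) ⟩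
      f 3 * t (2 Nat.+ j) + ι R 3                           ≈⟨ +-congʳ (*-congˡ t-step) ⟩
      f 3 * (t (1 Nat.+ j) + N) + ι R 3                     ≈⟨ spread-v _ _ _ ⟩
      (f 3 * t (1 Nat.+ j) + ι R 3) + f 3 * N               ∎)

  -- With f(3) = 3 the affine relation reads 2F(n) = 2T_n.
  F≈t : ∀ n → F (suc n) ≈ t (suc n)
  F≈t n = ι-cancelˡ 1 (∙-cancelʳ (ι R 3 + t (suc n)) _ _ (begin
    ι R 2 * F (suc n) + (ι R 3 + t (suc n))  ≈⟨ +-congˡ (+-congʳ (sym f3≈3)) ⟩
    ι R 2 * F (suc n) + (f 3 + t (suc n))    ≈⟨ affine-relation n ⟩
    f 3 * t (suc n) + ι R 3                  ≈⟨ +-congʳ (*-congʳ f3≈3) ⟩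
    ι R 3 * t (suc n) + ι R 3                ≈⟨ regroup (t (suc n)) ⟩
    ι R 2 * t (suc n) + (ι R 3 + t (suc n))  ∎))
    where
    regroup : ∀ x → ι R 3 * x + ι R 3 ≈ ι R 2 * x + (ι R 3 + x)
    regroup = solve 1 (λ x → :ι 3 :* x :+ :ι 3 := :ι 2 :* x :+ (:ι 3 :+ x)) refl

  f-is-identity : ∀ n → f (suc n) ≈ ι R (suc n)
  f-is-identity = identity-from-triangular F≈t

mainTheorem1 : ∀ {c ℓ : Level} (R : CommutativeRing c ℓ) → IsChar0Field R →
    (k : ℕ) → 3 ≤ k → (f : ℕ → CommutativeRing.Carrier R) → IsMultiplicative R f →
    ((x : Fin k → ℕ) → (∀ i → IsPosTriangular (x i)) →
      CommutativeRing._≈_ R (f (sumℕ x)) (sumR R (λ i → f (x i)))) →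
    ∀ n → 1 ≤ n → CommutativeRing._≈_ R (f n) (ι R n)
mainTheorem1 R char0-field (suc (suc (suc j))) (s≤s (s≤s (s≤s _))) f mul additive (suc n) (s≤s _) =
  Characterisation.f-is-identity R char0-field j f mul additive n
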